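{- Let $n\ge1$. The number of rows $i\ge 0$ of the intermediate firing configuration $F$ that contain at least one nonzero entry is even.
   Context: For a fixed integer $n\ge0$, define $F:\mathbb{Z}^2\to\mathbb{Z}_{\ge0}$ by $F(0,0)=2^n$, $F(x,y)=\lfloor F(x-1,y)/2\rfloor+\lfloor F(x,y-1)/2\rfloor$ for every $(x,y)\in\mathbb{Z}_{\ge0}^2\setminus\{(0,0)\}$, and $F(x,y)=0$ for $(x,y)$ outside the first quadrant. This is the intermediate firing configuration of chip-firing on the quadrant lattice graph (vertices $\mathbb{Z}_{\ge0}^2$, edges $(x,y)\to(x+1,y)$, $(x,y)\to(x,y+1)$; a vertex with at least 2 chips fires one chip to each out-neighbour) started with $2^n$ chips at the origin and fired row by row. Row $i$ consists of the points with $x+y=i$; only finitely many rows are nonzero. -}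

module Defs where

open import Data.Nat using (ℕ; zero; suc; _+_; _^_; _/_; _∸_; _<_; _≤_)
open import Data.Bool using (Bool; true; false; _∨_; if_then_else_)
open import Data.Nat using (_≡ᵇ_)

-- F n x y : the intermediate firing configuration for 2^n chips at the
-- origin, restricted to the first quadrant (it is 0 outside by definition).
F : ℕ → ℕ → ℕ → ℕ
F n zero    zero    = 2 ^ n
F n (suc x) zero    = F n x zero / 2
F n zero    (suc y) = F n zero y / 2
F n (suc x) (suc y) = F n x (suc y) / 2 + F n (suc x) y / 2

-- Row i = points (x , i ∸ x) with x ≤ i.  rowNonzero n i = true iff some
-- entry of row i is nonzero (checked for x = 0, …, i).
rowNonzeroUpTo : ℕ → ℕ → ℕ → Bool
rowNonzeroUpTo n i zero    = if F n 0 i ≡ᵇ 0 then false else true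
rowNonzeroUpTo n i (suc x) =
  (if F n (suc x) (i ∸ suc x) ≡ᵇ 0 then false else true) ∨ rowNonzeroUpTo n i x

rowNonzero : ℕ → ℕ → Bool
rowNonzero n i = rowNonzeroUpTo n i i

countNonzeroRows : ℕ → ℕ → ℕ
countNonzeroRows n zero    = 0
countNonzeroRows n (suc N) =
  (if rowNonzero n N then 1 else 0) + countNonzeroRows n N

-- Along a row x + y = i the entries of F increase towards the centre (induction
-- on the row, using the symmetry F x y = F y x), so a row vanishes iff its
-- central entry does, and a zero row forces all later rows to be zero.  For
-- n ≥ 1 the diagonal entry F m m is even (it is 2^n, or twice F m (m+1) / 2 by
-- symmetry) and F m (m+1) ≥ F m m / 2, so rows 2m and 2m+1 are either both
-- zero or both nonzero.  Finally F x y ≤ 2^n C(x+y, x) / 2^(x+y) and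
-- C(2m, m)² (2m+1) ≤ 16^m, which makes F m m vanish once 2m + 1 > 4^n.

module Submission where

open import Defs
open import Data.Nat using (ℕ; _+_; _≤_; _<_; _%_)
open import Data.Product using (Σ; _×_)
open import Relation.Binary.PropositionalEquality using (_≡_; _≢_)

open import Data.Bool using (Bool; true; false; _∨_; if_then_else_)
open import Data.Bool.Properties using (∨-zeroʳ)
open import Data.Nat
  using (zero; suc; _*_; _^_; _/_; _∸_; _≡ᵇ_; s≤s; _≤′_; ≤′-refl; ≤′-step; _≟_; _<?_; ≢-nonZero)
open import Data.Nat.Properties
open import Data.Nat.DivMod using (/-monoˡ-≤; m≥n⇒m/n>0; m/n*n≤m)
open import Data.Nat.Divisibility using (_∣_; divides; ∣⇒≤; _∣0; ∣-refl; m∣m*n; ∣m∣n⇒∣m+n; n∣m⇒m%n≡0)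
open import Data.Nat.Tactic.RingSolver using (solve-∀)
import Algebra.Properties.CommutativeSemigroup as CommSemigroupProperties
open import Data.Product using (_,_)
open import Data.Sum using (inj₁; inj₂)
open import Function using (_∘_; id)
open import Relation.Binary.PropositionalEquality using (refl; sym; trans; cong; cong₂; subst; module ≡-Reasoning)
open import Relation.Nullary using (yes; no; contradiction)

-- binomial x y = (x + y) choose x, the number of monotone lattice paths from (0,0) to (x,y)
binomial : ℕ → ℕ → ℕ
binomial zero    y       = 1
binomial (suc x) zero    = 1
binomial (suc x) (suc y) = binomial x (suc y) + binomial (suc x) y

binomial-zeroʳ : ∀ x → binomial x 0 ≡ 1
binomial-zeroʳ zero    = refl
binomial-zeroʳ (suc x) = refl

1+x*binomial[1+x,y] : ∀ x y → suc x * binomial (suc x) y ≡ (suc x + y) * binomial x y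
1+y*binomial[x,1+y] : ∀ x y → suc y * binomial x (suc y) ≡ (x + suc y) * binomial x y
1+x*binomial[1+x,y] x zero rewrite binomial-zeroʳ x | +-identityʳ x = refl
1+x*binomial[1+x,y] x (suc y) = begin
  suc x * (binomial x (suc y) + binomial (suc x) y)         ≡⟨ *-distribˡ-+ (suc x) (binomial x (suc y)) _ ⟩
  suc x * binomial x (suc y) + suc x * binomial (suc x) y   ≡⟨ cong (suc x * binomial x (suc y) +_) (1+x*binomial[1+x,y] x y) ⟩
  suc x * binomial x (suc y) + (suc x + y) * binomial x y   ≡⟨ cong (λ z → suc x * binomial x (suc y) + z * binomial x y) (sym (+-suc x y)) ⟩
  suc x * binomial x (suc y) + (x + suc y) * binomial x y   ≡⟨ cong (suc x * binomial x (suc y) +_) (sym (1+y*binomial[x,1+y] x y)) ⟩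
  suc x * binomial x (suc y) + suc y * binomial x (suc y)   ≡⟨ *-distribʳ-+ (binomial x (suc y)) (suc x) (suc y) ⟨
  (suc x + suc y) * binomial x (suc y)                      ∎
  where open ≡-Reasoning
1+y*binomial[x,1+y] zero y = refl
1+y*binomial[x,1+y] (suc x) y = begin
  suc y * (binomial x (suc y) + binomial (suc x) y)         ≡⟨ *-distribˡ-+ (suc y) (binomial x (suc y)) _ ⟩
  suc y * binomial x (suc y) + suc y * binomial (suc x) y   ≡⟨ cong (_+ suc y * binomial (suc x) y) (1+y*binomial[x,1+y] x y) ⟩
  (x + suc y) * binomial x y + suc y * binomial (suc x) y   ≡⟨ cong (λ z → z * binomial x y + suc y * binomial (suc x) y) (+-suc x y) ⟩
  (suc x + y) * binomial x y + suc y * binomial (suc x) y   ≡⟨ cong (_+ suc y * binomial (suc x) y) (sym (1+x*binomial[1+x,y] x y)) ⟩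
  suc x * binomial (suc x) y + suc y * binomial (suc x) y   ≡⟨ *-distribʳ-+ (binomial (suc x) y) (suc x) (suc y) ⟨
  (suc x + suc y) * binomial (suc x) y                      ∎
  where open ≡-Reasoning

central-binomial-suc : ∀ m → suc m * binomial (suc m) (suc m) ≡ 2 * (suc (m + m) * binomial m m)
central-binomial-suc m = *-cancelˡ-≡ _ _ (suc m) (begin
  suc m * (suc m * binomial (suc m) (suc m))       ≡⟨ cong (suc m *_) (1+x*binomial[1+x,y] m (suc m)) ⟩
  suc m * ((suc m + suc m) * binomial m (suc m))   ≡⟨ x∙yz≈y∙xz (suc m) (suc m + suc m) _ ⟩
  (suc m + suc m) * (suc m * binomial m (suc m))   ≡⟨ cong ((suc m + suc m) *_) (1+y*binomial[x,1+y] m m) ⟩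
  (suc m + suc m) * ((m + suc m) * binomial m m)   ≡⟨ regroup m (binomial m m) ⟩
  suc m * (2 * (suc (m + m) * binomial m m))       ∎)
  where
  open ≡-Reasoning
  open CommSemigroupProperties *-commutativeSemigroup using (x∙yz≈y∙xz)
  regroup : ∀ m b → (suc m + suc m) * ((m + suc m) * b) ≡ suc m * (2 * (suc (m + m) * b))
  regroup = solve-∀

central-binomial-bound : ∀ m → binomial m m * binomial m m * suc (m + m) ≤ 4 ^ m * 4 ^ m
central-binomial-bound zero    = ≤-refl
central-binomial-bound (suc m) = *-cancelˡ-≤ (suc m * suc m) (begin
  suc m * suc m * (B′ * B′ * suc (suc m + suc m))                 ≡⟨ regroup₁ m B′ ⟩
  (suc m * B′) * (suc m * B′) * suc (suc m + suc m)               ≡⟨ cong (λ z → z * z * suc (suc m + suc m)) (central-binomial-suc m) ⟩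
  (2 * (suc (m + m) * B)) * (2 * (suc (m + m) * B)) * suc (suc m + suc m)
                                                                  ≡⟨ regroup₂ m B ⟩
  4 * suc (m + m) * suc (suc m + suc m) * (B * B * suc (m + m))   ≤⟨ *-monoʳ-≤ c (central-binomial-bound m) ⟩
  4 * suc (m + m) * suc (suc m + suc m) * (4 ^ m * 4 ^ m)         ≤⟨ *-monoˡ-≤ (4 ^ m * 4 ^ m) (m≤m+n c 4) ⟩
  (4 * suc (m + m) * suc (suc m + suc m) + 4) * (4 ^ m * 4 ^ m)   ≡⟨ regroup₃ m (4 ^ m) ⟩
  suc m * suc m * (4 ^ suc m * 4 ^ suc m)                         ∎)
  where
  open ≤-Reasoning
  B  = binomial m m
  B′ = binomial (suc m) (suc m)
  c  = 4 * suc (m + m) * suc (suc m + suc m)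
  regroup₁ : ∀ m b → suc m * suc m * (b * b * suc (suc m + suc m)) ≡ (suc m * b) * (suc m * b) * suc (suc m + suc m)
  regroup₁ = solve-∀
  regroup₂ : ∀ m b → (2 * (suc (m + m) * b)) * (2 * (suc (m + m) * b)) * suc (suc m + suc m)
                   ≡ 4 * suc (m + m) * suc (suc m + suc m) * (b * b * suc (m + m))
  regroup₂ = solve-∀
  regroup₃ : ∀ m q → (4 * suc (m + m) * suc (suc m + suc m) + 4) * (q * q) ≡ suc m * suc m * ((4 * q) * (4 * q))
  regroup₃ = solve-∀

2^[m+m]≡4^m : ∀ m → 2 ^ (m + m) ≡ 4 ^ m
2^[m+m]≡4^m m = sym (trans (^-*-assoc 2 2 m) (cong (λ k → 2 ^ (m + k)) (+-identityʳ m)))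

m∣m^n : ∀ m {n} → 1 ≤ n → m ∣ m ^ n
m∣m^n m {suc n} _ = m∣m*n (m ^ n)

m/2*[2*p]≤m*p : ∀ m p → m / 2 * (2 * p) ≤ m * p
m/2*[2*p]≤m*p m p = begin
  m / 2 * (2 * p) ≡⟨ *-assoc (m / 2) 2 p ⟨
  m / 2 * 2 * p   ≤⟨ *-monoˡ-≤ p (m/n*n≤m m 2) ⟩
  m * p           ∎
  where open ≤-Reasoning

module _ (n : ℕ) where

  F-sym : ∀ x y → F n x y ≡ F n y x
  F-sym zero    zero    = refl
  F-sym zero    (suc y) = cong (_/ 2) (F-sym zero y)
  F-sym (suc x) zero    = cong (_/ 2) (F-sym x zero)
  F-sym (suc x) (suc y) =
    trans (cong₂ (λ a b → a / 2 + b / 2) (F-sym x (suc y)) (F-sym (suc x) y))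
          (+-comm (F n (suc y) x / 2) (F n y (suc x) / 2))

  F[x,1+y]≤F[1+x,y] : ∀ x y → x ≤ y → F n x (suc y) ≤ F n (suc x) y
  F[x,1+y]≤F[1+x,y] zero    zero    _ = ≤-refl
  F[x,1+y]≤F[1+x,y] zero    (suc y) _ = m≤m+n (F n 0 (suc y) / 2) (F n 1 y / 2)
  F[x,1+y]≤F[1+x,y] (suc x) (suc y) (s≤s x≤y) = begin
    F n x (2 + y) / 2 + F n (suc x) (suc y) / 2   ≤⟨ +-monoˡ-≤ _ (/-monoˡ-≤ 2 outer) ⟩
    F n (2 + x) y / 2 + F n (suc x) (suc y) / 2   ≡⟨ +-comm (F n (2 + x) y / 2) _ ⟩
    F n (suc x) (suc y) / 2 + F n (2 + x) y / 2   ∎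
    where
    open ≤-Reasoning
    outer : F n x (2 + y) ≤ F n (2 + x) y
    outer with m≤n⇒m<n∨m≡n x≤y
    ... | inj₁ x<y  = ≤-trans (F[x,1+y]≤F[1+x,y] x (suc y) (m≤n⇒m≤1+n x≤y)) (F[x,1+y]≤F[1+x,y] (suc x) y x<y)
    ... | inj₂ refl = ≤-reflexive (F-sym x (2 + x))

  F[x,d+y]≤F[d+x,y] : ∀ d x y → x + d ≤ y → F n x (d + y) ≤ F n (d + x) y
  F[x,d+y]≤F[d+x,y] zero    x y _ = ≤-refl
  F[x,d+y]≤F[d+x,y] (suc d) x y x+1+d≤y = begin
    F n x (suc (d + y))  ≤⟨ F[x,1+y]≤F[1+x,y] x (d + y) (≤-trans (m≤m+n x (suc d)) (≤-trans x+1+d≤y (m≤n+m y d))) ⟩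
    F n (suc x) (d + y)  ≤⟨ F[x,d+y]≤F[d+x,y] d (suc x) y (subst (_≤ y) (+-suc x d) x+1+d≤y) ⟩
    F n (d + suc x) y    ≡⟨ cong (λ z → F n z y) (+-suc d x) ⟩
    F n (suc d + x) y    ∎
    where open ≤-Reasoning

  F≤F[m,m]-below : ∀ x y m → x ≤ m → x + y ≡ m + m → F n x y ≤ F n m m
  F≤F[m,m]-below x y m x≤m x+y≡m+m with m≤n⇒∃[o]m+o≡n x≤m
  ... | d , refl = begin
    F n x y              ≡⟨ cong (F n x) (+-cancelˡ-≡ x y (d + (x + d)) (trans x+y≡m+m (+-assoc x d (x + d)))) ⟩
    F n x (d + (x + d))  ≤⟨ F[x,d+y]≤F[d+x,y] d x (x + d) ≤-refl ⟩
    F n (d + x) (x + d)  ≡⟨ cong (λ z → F n z (x + d)) (+-comm d x) ⟩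
    F n (x + d) (x + d)  ∎
    where open ≤-Reasoning

  F≤F[m,m] : ∀ x y m → x + y ≡ m + m → F n x y ≤ F n m m
  F≤F[m,m] x y m x+y≡m+m with ≤-total x m
  ... | inj₁ x≤m = F≤F[m,m]-below x y m x≤m x+y≡m+m
  ... | inj₂ m≤x = subst (_≤ F n m m) (F-sym y x) (F≤F[m,m]-below y x m y≤m (trans (+-comm y x) x+y≡m+m))
    where
    y≤m : y ≤ m
    y≤m = +-cancelˡ-≤ m y m (≤-trans (+-monoˡ-≤ y m≤x) (≤-reflexive x+y≡m+m))

  F[x,y]/2≤F[x,1+y] : ∀ x y → F n x y / 2 ≤ F n x (suc y)
  F[x,y]/2≤F[x,1+y] zero    y = ≤-refl
  F[x,y]/2≤F[x,1+y] (suc x) y = m≤n+m (F n (suc x) y / 2) (F n x (suc y) / 2)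

  F*2^[x+y]≤2^n*binomial : ∀ x y → F n x y * 2 ^ (x + y) ≤ 2 ^ n * binomial x y
  F*2^[x+y]≤2^n*binomial zero    zero    = ≤-refl
  F*2^[x+y]≤2^n*binomial (suc x) zero    = begin
    F n x 0 / 2 * (2 * 2 ^ (x + 0))  ≤⟨ m/2*[2*p]≤m*p (F n x 0) _ ⟩
    F n x 0 * 2 ^ (x + 0)            ≤⟨ F*2^[x+y]≤2^n*binomial x zero ⟩
    2 ^ n * binomial x 0             ≡⟨ cong (2 ^ n *_) (binomial-zeroʳ x) ⟩
    2 ^ n * 1                        ∎
    where open ≤-Reasoning
  F*2^[x+y]≤2^n*binomial zero    (suc y) =
    ≤-trans (m/2*[2*p]≤m*p (F n 0 y) _) (F*2^[x+y]≤2^n*binomial zero y)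
  F*2^[x+y]≤2^n*binomial (suc x) (suc y) = begin
    (a / 2 + b / 2) * (2 * p)                         ≡⟨ *-distribʳ-+ (2 * p) (a / 2) (b / 2) ⟩
    a / 2 * (2 * p) + b / 2 * (2 * p)                 ≤⟨ +-mono-≤ (m/2*[2*p]≤m*p a p) (m/2*[2*p]≤m*p b p) ⟩
    a * p + b * p                                     ≡⟨ cong (λ k → a * p + b * 2 ^ k) (+-suc x y) ⟩
    a * p + b * 2 ^ (suc x + y)                       ≤⟨ +-mono-≤ (F*2^[x+y]≤2^n*binomial x (suc y)) (F*2^[x+y]≤2^n*binomial (suc x) y) ⟩
    2 ^ n * binomial x (suc y) + 2 ^ n * binomial (suc x) y ≡⟨ *-distribˡ-+ (2 ^ n) (binomial x (suc y)) _ ⟨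
    2 ^ n * binomial (suc x) (suc y)                  ∎
    where
    open ≤-Reasoning
    a = F n x (suc y)
    b = F n (suc x) y
    p = 2 ^ (x + suc y)

  F[m,m]≢0⇒m+m<2^n*2^n : ∀ m → F n m m ≢ 0 → m + m < 2 ^ n * 2 ^ n
  F[m,m]≢0⇒m+m<2^n*2^n m F≢0 = *-cancelˡ-≤ (P * P) {{m*n≢0 P P {{m^n≢0 4 m}} {{m^n≢0 4 m}}}} (begin
    P * P * suc (m + m)            ≤⟨ *-monoˡ-≤ (suc (m + m)) (*-mono-≤ P≤Q*B P≤Q*B) ⟩
    Q * B * (Q * B) * suc (m + m)  ≡⟨ regroup Q B (suc (m + m)) ⟩
    Q * Q * (B * B * suc (m + m))  ≤⟨ *-monoʳ-≤ (Q * Q) (central-binomial-bound m) ⟩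
    Q * Q * (P * P)                ≡⟨ *-comm (Q * Q) (P * P) ⟩
    P * P * (Q * Q)                ∎)
    where
    open ≤-Reasoning
    P = 4 ^ m
    Q = 2 ^ n
    B = binomial m m
    P≤Q*B : P ≤ Q * B
    P≤Q*B = begin
      4 ^ m                  ≡⟨ 2^[m+m]≡4^m m ⟨
      2 ^ (m + m)            ≤⟨ m≤n*m (2 ^ (m + m)) (F n m m) {{≢-nonZero F≢0}} ⟩
      F n m m * 2 ^ (m + m)  ≤⟨ F*2^[x+y]≤2^n*binomial m m ⟩
      Q * B                  ∎
    regroup : ∀ q b t → q * b * (q * b) * t ≡ q * q * (b * b * t)
    regroup = solve-∀

  2∣F[m,m] : 1 ≤ n → ∀ m → 2 ∣ F n m m
  2∣F[m,m] 1≤n zero    = m∣m^n 2 1≤n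
  2∣F[m,m] _   (suc m) = divides a (begin
    a + F n (suc m) m / 2  ≡⟨ cong (λ z → a + z / 2) (F-sym (suc m) m) ⟩
    a + a                  ≡⟨ cong (a +_) (+-identityʳ a) ⟨
    2 * a                  ≡⟨ *-comm 2 a ⟩
    a * 2                  ∎)
    where
    open ≡-Reasoning
    a = F n m (suc m) / 2

  F[m,m]≢0⇒F[m,1+m]≢0 : 1 ≤ n → ∀ m → F n m m ≢ 0 → F n m (suc m) ≢ 0
  F[m,m]≢0⇒F[m,1+m]≢0 1≤n m F≢0 = m<n⇒n≢0 (begin-strict
    0            <⟨ m≥n⇒m/n>0 (∣⇒≤ {{≢-nonZero F≢0}} (2∣F[m,m] 1≤n m)) ⟩
    F n m m / 2  ≤⟨ F[x,y]/2≤F[x,1+y] m m ⟩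
    F n m (suc m) ∎)
    where open ≤-Reasoning

  ZeroRow : ℕ → Set
  ZeroRow i = ∀ x y → x + y ≡ i → F n x y ≡ 0

  ZeroRow-suc : ∀ {i} → ZeroRow i → ZeroRow (suc i)
  ZeroRow-suc zero-row zero    zero    ()
  ZeroRow-suc zero-row (suc x) zero    eq = cong (_/ 2) (zero-row x 0 (suc-injective eq))
  ZeroRow-suc zero-row zero    (suc y) eq = cong (_/ 2) (zero-row 0 y (suc-injective eq))
  ZeroRow-suc zero-row (suc x) (suc y) eq =
    cong₂ (λ a b → a / 2 + b / 2) (zero-row x (suc y) (suc-injective eq))
                                  (zero-row (suc x) y (trans (sym (+-suc x y)) (suc-injective eq)))

  ZeroRow-mono : ∀ {i j} → i ≤ j → ZeroRow i → ZeroRow j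
  ZeroRow-mono i≤j = go (≤⇒≤′ i≤j)
    where
    go : ∀ {i j} → i ≤′ j → ZeroRow i → ZeroRow j
    go ≤′-refl       = id
    go (≤′-step i≤j) = ZeroRow-suc ∘ go i≤j

  F[m,m]≡0⇒ZeroRow : ∀ m → F n m m ≡ 0 → ZeroRow (m + m)
  F[m,m]≡0⇒ZeroRow m F≡0 x y x+y≡m+m = n≤0⇒n≡0 (≤-trans (F≤F[m,m] x y m x+y≡m+m) (≤-reflexive F≡0))

  nonzero? : ℕ → Bool
  nonzero? v = if v ≡ᵇ 0 then false else true

  nonzero?-≢0 : ∀ {v} → v ≢ 0 → nonzero? v ≡ true
  nonzero?-≢0 {zero}  v≢0 = contradiction refl v≢0
  nonzero?-≢0 {suc v} _   = refl

  rowNonzeroUpTo≡true : ∀ {i} j x → x ≤ j → F n x (i ∸ x) ≢ 0 → rowNonzeroUpTo n i j ≡ true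
  rowNonzeroUpTo≡true zero    zero    _   F≢0 = nonzero?-≢0 F≢0
  rowNonzeroUpTo≡true {i} (suc j) x x≤j F≢0 with m≤n⇒m<n∨m≡n x≤j
  ... | inj₁ x<j  = trans (cong (nonzero? (F n (suc j) (i ∸ suc j)) ∨_) (rowNonzeroUpTo≡true j x (≤-pred x<j) F≢0))
                          (∨-zeroʳ _)
  ... | inj₂ refl = cong (_∨ rowNonzeroUpTo n i j) (nonzero?-≢0 F≢0)

  F≢0⇒rowNonzero≡true : ∀ x y → F n x y ≢ 0 → rowNonzero n (x + y) ≡ true
  F≢0⇒rowNonzero≡true x y F≢0 =
    rowNonzeroUpTo≡true (x + y) x (m≤m+n x y) (subst (λ z → F n x z ≢ 0) (sym (m+n∸m≡n x y)) F≢0)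

  ZeroRow⇒rowNonzeroUpTo≡false : ∀ {i} j → j ≤ i → ZeroRow i → rowNonzeroUpTo n i j ≡ false
  ZeroRow⇒rowNonzeroUpTo≡false {i} zero    _   zero-row = cong nonzero? (zero-row 0 i refl)
  ZeroRow⇒rowNonzeroUpTo≡false {i} (suc j) j<i zero-row =
    cong₂ _∨_ (cong nonzero? (zero-row (suc j) (i ∸ suc j) (m+[n∸m]≡n j<i)))
              (ZeroRow⇒rowNonzeroUpTo≡false j (<⇒≤ j<i) zero-row)

  ZeroRow⇒rowNonzero≡false : ∀ {i} → ZeroRow i → rowNonzero n i ≡ false
  ZeroRow⇒rowNonzero≡false {i} = ZeroRow⇒rowNonzeroUpTo≡false i ≤-refl

  rowNonzero[1+m+m]≡rowNonzero[m+m] : 1 ≤ n → ∀ m → rowNonzero n (suc (m + m)) ≡ rowNonzero n (m + m)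
  rowNonzero[1+m+m]≡rowNonzero[m+m] 1≤n m with F n m m ≟ 0
  ... | yes F≡0 = trans (ZeroRow⇒rowNonzero≡false (ZeroRow-suc zero-row)) (sym (ZeroRow⇒rowNonzero≡false zero-row))
    where zero-row = F[m,m]≡0⇒ZeroRow m F≡0
  ... | no  F≢0 = trans (subst (λ i → rowNonzero n i ≡ true) (+-suc m m) odd-row) (sym (F≢0⇒rowNonzero≡true m m F≢0))
    where odd-row = F≢0⇒rowNonzero≡true m (suc m) (F[m,m]≢0⇒F[m,1+m]≢0 1≤n m F≢0)

  2∣countNonzeroRows[m+m] : 1 ≤ n → ∀ m → 2 ∣ countNonzeroRows n (m + m)
  2∣countNonzeroRows[m+m] _   zero = 2 ∣0
  2∣countNonzeroRows[m+m] 1≤n (suc m)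
    rewrite +-suc m m | rowNonzero[1+m+m]≡rowNonzero[m+m] 1≤n m with rowNonzero n (m + m)
  ... | true  = ∣m∣n⇒∣m+n (∣-refl {2}) (2∣countNonzeroRows[m+m] 1≤n m)
  ... | false = 2∣countNonzeroRows[m+m] 1≤n m

proposition6p8 : (n : ℕ) → 1 ≤ n →
    Σ ℕ (λ N → ((x y : ℕ) → F n x y ≢ 0 → x + y < N)
             × (countNonzeroRows n N % 2 ≡ 0))
proposition6p8 n 1≤n = M + M , F≢0⇒x+y<M+M , n∣m⇒m%n≡0 _ 2 (2∣countNonzeroRows[m+m] n 1≤n M)
  where
  M = 2 ^ n * 2 ^ n
  F[M,M]≡0 : F n M M ≡ 0
  F[M,M]≡0 with F n M M ≟ 0
  ... | yes F≡0 = F≡0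
  ... | no  F≢0 = contradiction (F[m,m]≢0⇒m+m<2^n*2^n n M F≢0) (m+n≮m M M)
  F≢0⇒x+y<M+M : (x y : ℕ) → F n x y ≢ 0 → x + y < M + M
  F≢0⇒x+y<M+M x y F≢0 with x + y <? M + M
  ... | yes x+y<M+M = x+y<M+M
  ... | no  x+y≮M+M = contradiction (ZeroRow-mono n (≮⇒≥ x+y≮M+M) (F[m,m]≡0⇒ZeroRow n M F[M,M]≡0) x y refl) F≢0
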